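{- For any formula $\alpha$ over a finite signature $\Sigma$, the set of equilibrium models of $\alpha$ equals $[\![\alpha]\!]_c\setminus\big([\![\alpha]\!]\setminus\mathcal I_c\big)\uparrow$.
   Context: $\Sigma$ is a finite set of atoms. Formulas are given by $\alpha ::= \bot \mid p \mid \alpha_1\wedge\alpha_2 \mid \alpha_1\vee\alpha_2 \mid \alpha_1\rightarrow\alpha_2$ with $p\in\Sigma$. A partial interpretation is a map $v:\Sigma\to\{0,1,2\}$; $\mathcal I$ is the set of all of them and $\mathcal I_c$ the set of classical ones (no atom mapped to $1$). The $G_3$ valuation extends $v$ to formulas: $v(\bot)=0$, $v(\alpha\wedge\beta)=\min(v(\alpha),v(\beta))$, $v(\alpha\vee\beta)=\max(v(\alpha),v(\beta))$, $v(\alpha\to\beta)=2$ if $v(\alpha)\le v(\beta)$ and $=v(\beta)$ otherwise; $v$ is a model of $\alpha$ iff $v(\alpha)=2$. The order on $\mathcal I$: $u\le v$ iff for every atom $p$, $u(p)\le v(p)$ and ($u(p)=0$ implies $v(p)=0$). A classical interpretation $v\in\mathcal I_c$ is an equilibrium model of $\alpha$ iff it is a $\le$-minimal model of $\alpha$. For $S\subseteq\mathcal I$: $\overline S=\mathcal I\setminus S$; $S_c=S\cap\mathcal I_c$; $S\downarrow=\{u\in\mathcal I:\exists v\in S,\ v\ge u\}$; $S\uparrow=\{u\in\mathcal I:\exists v\in S,\ v\le u\}$. The denotation: $[\![\bot]\!]=\emptyset$; $[\![p]\!]=\{v\in\mathcal I: v(p)=2\}$; $[\![\alpha\wedge\beta]\!]=[\![\alpha]\!]\cap[\![\beta]\!]$;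 $[\![\alpha\vee\beta]\!]=[\![\alpha]\!]\cup[\![\beta]\!]$; $[\![\alpha\to\beta]\!]=\big(\overline{[\![\alpha]\!]}\cup[\![\beta]\!]\big)\cap\big(\overline{[\![\alpha]\!]}\cup[\![\beta]\!]\big)_c\downarrow$. -}

module Defs where

open import Data.Nat using (ℕ)
open import Data.Fin using (Fin)
open import Data.Bool using (Bool; true; false)
open import Data.Unit using (⊤)
open import Data.Empty using (⊥)
open import Data.Product using (_×_; Σ-syntax)
open import Data.Sum using (_⊎_)
open import Relation.Nullary using (¬_)
open import Relation.Binary.PropositionalEquality using (_≡_)

-- Truth values 0 < 1 < 2 of G3 (Here-and-There)
data V3 : Set where
  v0 v1 v2 : V3

_≤₃_ : V3 → V3 → Set
v0 ≤₃ _  = ⊤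
v1 ≤₃ v0 = ⊥
v1 ≤₃ _  = ⊤
v2 ≤₃ v2 = ⊤
v2 ≤₃ _  = ⊥

_≤₃?_ : V3 → V3 → Bool
v0 ≤₃? _  = true
v1 ≤₃? v0 = false
v1 ≤₃? _  = true
v2 ≤₃? v2 = true
v2 ≤₃? _  = false

min₃ : V3 → V3 → V3
min₃ x y with x ≤₃? y
... | true  = x
... | false = y

max₃ : V3 → V3 → V3
max₃ x y with x ≤₃? y
... | true  = y
... | false = x

data Formula (n : ℕ) : Set where
  ⊥ᶠ   : Formula n
  atom : Fin n → Formula n
  _∧ᶠ_ : Formula n → Formula n → Formula n
  _∨ᶠ_ : Formula n → Formula n → Formula n
  _⇒ᶠ_ : Formula n → Formula n → Formula n

Interp : ℕ → Set
Interp n = Fin n → V3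

eval : {n : ℕ} → Interp n → Formula n → V3
eval v ⊥ᶠ       = v0
eval v (atom p) = v p
eval v (a ∧ᶠ b) = min₃ (eval v a) (eval v b)
eval v (a ∨ᶠ b) = max₃ (eval v a) (eval v b)
eval v (a ⇒ᶠ b) with eval v a ≤₃? eval v b
... | true  = v2
... | false = eval v b

IsModel : {n : ℕ} → Formula n → Interp n → Set
IsModel α v = eval v α ≡ v2

IsClassical : {n : ℕ} → Interp n → Set
IsClassical v = ∀ p → ¬ (v p ≡ v1)

_≤ᴵ_ : {n : ℕ} → Interp n → Interp n → Set
u ≤ᴵ v = ∀ p → (u p ≤₃ v p) × (u p ≡ v0 → v p ≡ v0)

_≈ᴵ_ : {n : ℕ} → Interp n → Interp n → Set
u ≈ᴵ v = ∀ p → u p ≡ v p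

IsEquilibrium : {n : ℕ} → Formula n → Interp n → Set
IsEquilibrium α v =
  IsClassical v × IsModel α v × (∀ u → IsModel α u → u ≤ᴵ v → u ≈ᴵ v)

ISet : ℕ → Set₁
ISet n = Interp n → Set

∅ˢ : {n : ℕ} → ISet n
∅ˢ _ = ⊥

_∩ˢ_ : {n : ℕ} → ISet n → ISet n → ISet n
(S ∩ˢ T) v = S v × T v

_∪ˢ_ : {n : ℕ} → ISet n → ISet n → ISet n
(S ∪ˢ T) v = S v ⊎ T v

_∖ˢ_ : {n : ℕ} → ISet n → ISet n → ISet n
(S ∖ˢ T) v = S v × ¬ T v

compˢ : {n : ℕ} → ISet n → ISet n
compˢ S v = ¬ S v

_ᶜˡ : {n : ℕ} → ISet n → ISet n
(S ᶜˡ) v = S v × IsClassical v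

Iᶜ : {n : ℕ} → ISet n
Iᶜ = IsClassical

_↓ : {n : ℕ} → ISet n → ISet n
(S ↓) u = Σ[ v ∈ Interp _ ] (S v × u ≤ᴵ v)

_↑ : {n : ℕ} → ISet n → ISet n
(S ↑) u = Σ[ v ∈ Interp _ ] (S v × v ≤ᴵ u)

⟦_⟧ : {n : ℕ} → Formula n → ISet n
⟦ ⊥ᶠ ⟧     = ∅ˢ
⟦ atom p ⟧ = λ v → v p ≡ v2
⟦ a ∧ᶠ b ⟧ = ⟦ a ⟧ ∩ˢ ⟦ b ⟧
⟦ a ∨ᶠ b ⟧ = ⟦ a ⟧ ∪ˢ ⟦ b ⟧
⟦ a ⇒ᶠ b ⟧ = (compˢ ⟦ a ⟧ ∪ˢ ⟦ b ⟧) ∩ˢ (((compˢ ⟦ a ⟧ ∪ˢ ⟦ b ⟧) ᶜˡ) ↓)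

-- Raising every value 1 to 2 sends an interpretation v to close v, its "there" world: the
-- unique classical interpretation above v, and a homomorphism of the G3 connectives. So
-- v(α → β) = 2 iff ¬α ∨ β holds classically both at v and at close v, which is what the
-- downward closure of the classical part expresses in ⟦α → β⟧; hence ⟦α⟧ is the set of
-- models of α. Below a classical v the interpretations other than v are exactly the
-- non-classical ones, so minimality of a classical model v means that no non-classical
-- model lies below it.
module Submission where

open import Defs
open import Data.Nat using (ℕ)
open import Data.Product using (_×_; _,_)
open import Data.Sum using (_⊎_; inj₁; inj₂)
open import Data.Bool using (true; false)
open import Data.Unit using (tt)
open import Data.Empty using (⊥-elim)
open import Data.Product.Function.NonDependent.Propositional using (_×-⇔_)
open import Data.Sum.Function.Propositional using (_⊎-⇔_)
open import Function using (_⇔_; mk⇔; Equivalence)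
open import Function.Related.Propositional using (equivalence; module EquationalReasoning)
open import Function.Related.TypeIsomorphisms using (¬-cong-⇔)
open import Function.Properties.Equivalence using () renaming (refl to ⇔-refl; sym to ⇔-sym; trans to ⇔-trans)
open import Relation.Nullary using (¬_)
open import Relation.Binary.PropositionalEquality using (_≡_; _≢_; refl; sym; trans; cong; cong₂; subst₂; module ≡-Reasoning)

open Equivalence using (to; from)

close₃ : V3 → V3
close₃ v0 = v0
close₃ v1 = v2
close₃ v2 = v2

_⊑₃_ : V3 → V3 → Set
a ⊑₃ b = (a ≤₃ b) × (a ≡ v0 → b ≡ v0)

close₃-classical : ∀ a → close₃ a ≢ v1
close₃-classical v0 ()
close₃-classical v1 ()
close₃-classical v2 ()

close₃-fixes-classical : ∀ {a} → a ≢ v1 → close₃ a ≡ a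
close₃-fixes-classical {v0} _ = refl
close₃-fixes-classical {v1} c = ⊥-elim (c refl)
close₃-fixes-classical {v2} _ = refl

⊑₃-close₃ : ∀ a → a ⊑₃ close₃ a
⊑₃-close₃ v0 = tt , λ _ → refl
⊑₃-close₃ v1 = tt , λ ()
⊑₃-close₃ v2 = tt , λ ()

⊑₃-classical⇒close₃ : ∀ a {b} → b ≢ v1 → a ⊑₃ b → b ≡ close₃ a
⊑₃-classical⇒close₃ v0       _ (_ , b≡v0) = b≡v0 refl
⊑₃-classical⇒close₃ v1 {v0} _ (() , _)
⊑₃-classical⇒close₃ v1 {v1} c _ = ⊥-elim (c refl)
⊑₃-classical⇒close₃ v1 {v2} _ _ = refl
⊑₃-classical⇒close₃ v2 {v0} _ (() , _)
⊑₃-classical⇒close₃ v2 {v1} _ (() , _)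
⊑₃-classical⇒close₃ v2 {v2} _ _ = refl

imp₃ : V3 → V3 → V3
imp₃ a b with a ≤₃? b
... | true  = v2
... | false = b

close₃-min₃ : ∀ a b → close₃ (min₃ a b) ≡ min₃ (close₃ a) (close₃ b)
close₃-min₃ v0 _  = refl
close₃-min₃ v1 v0 = refl
close₃-min₃ v1 v1 = refl
close₃-min₃ v1 v2 = refl
close₃-min₃ v2 v0 = refl
close₃-min₃ v2 v1 = refl
close₃-min₃ v2 v2 = refl

close₃-max₃ : ∀ a b → close₃ (max₃ a b) ≡ max₃ (close₃ a) (close₃ b)
close₃-max₃ v0 v0 = refl
close₃-max₃ v0 v1 = refl
close₃-max₃ v0 v2 = refl
close₃-max₃ v1 v0 = refl
close₃-max₃ v1 v1 = refl
close₃-max₃ v1 v2 = refl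
close₃-max₃ v2 v0 = refl
close₃-max₃ v2 v1 = refl
close₃-max₃ v2 v2 = refl

close₃-imp₃ : ∀ a b → close₃ (imp₃ a b) ≡ imp₃ (close₃ a) (close₃ b)
close₃-imp₃ v0 v0 = refl
close₃-imp₃ v0 v1 = refl
close₃-imp₃ v0 v2 = refl
close₃-imp₃ v1 v0 = refl
close₃-imp₃ v1 v1 = refl
close₃-imp₃ v1 v2 = refl
close₃-imp₃ v2 v0 = refl
close₃-imp₃ v2 v1 = refl
close₃-imp₃ v2 v2 = refl

min₃≡v2⇔ : ∀ a b → min₃ a b ≡ v2 ⇔ (a ≡ v2 × b ≡ v2)
min₃≡v2⇔ a b = mk⇔ (to′ a b) λ { (refl , refl) → refl }
  where
  to′ : ∀ a b → min₃ a b ≡ v2 → a ≡ v2 × b ≡ v2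
  to′ v2 v2 _ = refl , refl
  to′ v0 _  ()
  to′ v1 v0 ()
  to′ v1 v1 ()
  to′ v1 v2 ()
  to′ v2 v0 ()
  to′ v2 v1 ()

max₃≡v2⇔ : ∀ a b → max₃ a b ≡ v2 ⇔ (a ≡ v2 ⊎ b ≡ v2)
max₃≡v2⇔ a b = mk⇔ (to′ a b) (from′ a b)
  where
  to′ : ∀ a b → max₃ a b ≡ v2 → a ≡ v2 ⊎ b ≡ v2
  to′ v2 _  _ = inj₁ refl
  to′ v0 v2 _ = inj₂ refl
  to′ v1 v2 _ = inj₂ refl
  to′ v0 v0 ()
  to′ v0 v1 ()
  to′ v1 v0 ()
  to′ v1 v1 ()
  from′ : ∀ a b → a ≡ v2 ⊎ b ≡ v2 → max₃ a b ≡ v2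
  from′ v2 v0 _ = refl
  from′ v2 v1 _ = refl
  from′ v2 v2 _ = refl
  from′ v0 v2 _ = refl
  from′ v1 v2 _ = refl
  from′ v0 v0 (inj₁ ())
  from′ v0 v0 (inj₂ ())
  from′ v0 v1 (inj₁ ())
  from′ v0 v1 (inj₂ ())
  from′ v1 v0 (inj₁ ())
  from′ v1 v0 (inj₂ ())
  from′ v1 v1 (inj₁ ())
  from′ v1 v1 (inj₂ ())

ClassicalImp : V3 → V3 → Set
ClassicalImp a b = a ≢ v2 ⊎ b ≡ v2

imp₃≡v2⇔ : ∀ a b → imp₃ a b ≡ v2 ⇔ (ClassicalImp a b × ClassicalImp (close₃ a) (close₃ b))
imp₃≡v2⇔ a b = mk⇔ (to′ a b) (from′ a b)
  where
  to′ : ∀ a b → imp₃ a b ≡ v2 → ClassicalImp a b × ClassicalImp (close₃ a) (close₃ b)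
  to′ v0 v0 _ = inj₁ (λ ()) , inj₁ (λ ())
  to′ v0 v1 _ = inj₁ (λ ()) , inj₂ refl
  to′ v0 v2 _ = inj₂ refl , inj₂ refl
  to′ v1 v1 _ = inj₁ (λ ()) , inj₂ refl
  to′ v1 v2 _ = inj₂ refl , inj₂ refl
  to′ v2 v2 _ = inj₂ refl , inj₂ refl
  to′ v1 v0 ()
  to′ v2 v0 ()
  to′ v2 v1 ()
  from′ : ∀ a b → ClassicalImp a b × ClassicalImp (close₃ a) (close₃ b) → imp₃ a b ≡ v2
  from′ v0 _  _ = refl
  from′ v1 v1 _ = refl
  from′ v1 v2 _ = refl
  from′ v2 v2 _ = refl
  from′ v1 v0 (_ , inj₁ v2≢v2) = ⊥-elim (v2≢v2 refl)
  from′ v2 v0 (inj₁ v2≢v2 , _) = ⊥-elim (v2≢v2 refl)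
  from′ v2 v1 (inj₁ v2≢v2 , _) = ⊥-elim (v2≢v2 refl)
  from′ v1 v0 (_ , inj₂ ())
  from′ v2 v0 (inj₂ () , _)
  from′ v2 v1 (inj₂ () , _)

close : {n : ℕ} → Interp n → Interp n
close v p = close₃ (v p)

close-classical : {n : ℕ} (v : Interp n) → IsClassical (close v)
close-classical v p = close₃-classical (v p)

≤ᴵ-close : {n : ℕ} (v : Interp n) → v ≤ᴵ close v
≤ᴵ-close v p = ⊑₃-close₃ (v p)

classical-above⇒≈close : {n : ℕ} {v w : Interp n} → IsClassical w → v ≤ᴵ w → w ≈ᴵ close v
classical-above⇒≈close {v = v} cw v≤w p = ⊑₃-classical⇒close₃ (v p) (cw p) (v≤w p)

≤ᴵ-classical⇒≈ : {n : ℕ} {u v : Interp n} → IsClassical u → IsClassical v → u ≤ᴵ v → u ≈ᴵ v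
≤ᴵ-classical⇒≈ cu cv u≤v p =
  sym (trans (classical-above⇒≈close cv u≤v p) (close₃-fixes-classical (cu p)))

eval-⇒ : {n : ℕ} (v : Interp n) (a b : Formula n) →
         eval v (a ⇒ᶠ b) ≡ imp₃ (eval v a) (eval v b)
eval-⇒ v a b with eval v a ≤₃? eval v b
... | true  = refl
... | false = refl

eval-close : {n : ℕ} (v : Interp n) (α : Formula n) → eval (close v) α ≡ close₃ (eval v α)
eval-close v ⊥ᶠ       = refl
eval-close v (atom p) = refl
eval-close v (a ∧ᶠ b) =
  trans (cong₂ min₃ (eval-close v a) (eval-close v b)) (sym (close₃-min₃ (eval v a) (eval v b)))
eval-close v (a ∨ᶠ b) =
  trans (cong₂ max₃ (eval-close v a) (eval-close v b)) (sym (close₃-max₃ (eval v a) (eval v b)))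
eval-close v (a ⇒ᶠ b) = begin
  eval (close v) (a ⇒ᶠ b)                       ≡⟨ eval-⇒ (close v) a b ⟩
  imp₃ (eval (close v) a) (eval (close v) b)    ≡⟨ cong₂ imp₃ (eval-close v a) (eval-close v b) ⟩
  imp₃ (close₃ (eval v a)) (close₃ (eval v b))  ≡⟨ sym (close₃-imp₃ (eval v a) (eval v b)) ⟩
  close₃ (imp₃ (eval v a) (eval v b))           ≡⟨ cong close₃ (sym (eval-⇒ v a b)) ⟩
  close₃ (eval v (a ⇒ᶠ b))                      ∎
  where open ≡-Reasoning

eval-≈ : {n : ℕ} {u w : Interp n} → u ≈ᴵ w → (α : Formula n) → eval u α ≡ eval w α
eval-≈ u≈w ⊥ᶠ       = refl
eval-≈ u≈w (atom p) = u≈w p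
eval-≈ u≈w (a ∧ᶠ b) = cong₂ min₃ (eval-≈ u≈w a) (eval-≈ u≈w b)
eval-≈ u≈w (a ∨ᶠ b) = cong₂ max₃ (eval-≈ u≈w a) (eval-≈ u≈w b)
eval-≈ {u = u} {w} u≈w (a ⇒ᶠ b) =
  trans (eval-⇒ u a b) (trans (cong₂ imp₃ (eval-≈ u≈w a) (eval-≈ u≈w b)) (sym (eval-⇒ w a b)))

Respects≈ᴵ : {n : ℕ} → ISet n → Set
Respects≈ᴵ S = ∀ {u w} → u ≈ᴵ w → S u → S w

-- The only classical interpretation above v is close v.
classical-↓⇔close : {n : ℕ} {S : ISet n} {v : Interp n} →
                    Respects≈ᴵ S → ((S ᶜˡ) ↓) v ⇔ S (close v)
classical-↓⇔close {v = v} resp = mk⇔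
  (λ (w , (sw , cw) , v≤w) → resp (classical-above⇒≈close cw v≤w) sw)
  (λ s → close v , (s , close-classical v) , ≤ᴵ-close v)

⟦⟧⇔IsModel : {n : ℕ} (α : Formula n) (v : Interp n) → ⟦ α ⟧ v ⇔ IsModel α v
⟦⟧⇔IsModel ⊥ᶠ       v = mk⇔ (λ ()) (λ ())
⟦⟧⇔IsModel (atom p) v = ⇔-refl
⟦⟧⇔IsModel (a ∧ᶠ b) v =
  ⇔-trans (⟦⟧⇔IsModel a v ×-⇔ ⟦⟧⇔IsModel b v) (⇔-sym (min₃≡v2⇔ (eval v a) (eval v b)))
⟦⟧⇔IsModel (a ∨ᶠ b) v =
  ⇔-trans (⟦⟧⇔IsModel a v ⊎-⇔ ⟦⟧⇔IsModel b v) (⇔-sym (max₃≡v2⇔ (eval v a) (eval v b)))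
⟦⟧⇔IsModel {n} (a ⇒ᶠ b) v = begin
  ⟦ a ⇒ᶠ b ⟧ v
    ∼⟨ X⇔ v ×-⇔ classical-↓⇔close X-resp ⟩
  (ClassicalImp (eval v a) (eval v b) × X (close v))
    ∼⟨ ⇔-refl ×-⇔ X⇔ (close v) ⟩
  (ClassicalImp (eval v a) (eval v b) × ClassicalImp (eval (close v) a) (eval (close v) b))
    ≡⟨ cong₂ (λ x y → ClassicalImp (eval v a) (eval v b) × ClassicalImp x y)
             (eval-close v a) (eval-close v b) ⟩
  (ClassicalImp (eval v a) (eval v b) × ClassicalImp (close₃ (eval v a)) (close₃ (eval v b)))
    ∼⟨ ⇔-sym (imp₃≡v2⇔ (eval v a) (eval v b)) ⟩
  imp₃ (eval v a) (eval v b) ≡ v2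
    ≡⟨ cong (_≡ v2) (sym (eval-⇒ v a b)) ⟩
  IsModel (a ⇒ᶠ b) v ∎
  where
  open EquationalReasoning {k = equivalence}
  X : ISet n
  X = compˢ ⟦ a ⟧ ∪ˢ ⟦ b ⟧
  X⇔ : ∀ w → X w ⇔ ClassicalImp (eval w a) (eval w b)
  X⇔ w = ¬-cong-⇔ (⟦⟧⇔IsModel a w) ⊎-⇔ ⟦⟧⇔IsModel b w
  X-resp : Respects≈ᴵ X
  X-resp {u} {w} u≈w x =
    from (X⇔ w) (subst₂ ClassicalImp (eval-≈ u≈w a) (eval-≈ u≈w b) (to (X⇔ u) x))

Minimal : {n : ℕ} → ISet n → Interp n → Set
Minimal S v = ∀ u → S u → u ≤ᴵ v → u ≈ᴵ v

-- Below a classical v, the elements different from v are exactly the non-classical ones.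
minimal⇔no-nonclassical-below : {n : ℕ} {S : ISet n} {v : Interp n} →
                                IsClassical v → Minimal S v ⇔ (¬ ((S ∖ˢ Iᶜ) ↑) v)
minimal⇔no-nonclassical-below cv = mk⇔
  (λ min (u , (su , nonclassical) , u≤v) →
     nonclassical (λ p up≡v1 → cv p (trans (sym (min u su u≤v p)) up≡v1)))
  (λ none u su u≤v →
     ≤ᴵ-classical⇒≈ (λ p up≡v1 → none (u , (su , λ cu → cu p up≡v1) , u≤v)) cv u≤v)

theorem7 : (n : ℕ) (α : Formula n) (v : Interp n) →
    (IsEquilibrium α v → ((⟦ α ⟧ ᶜˡ) ∖ˢ ((⟦ α ⟧ ∖ˢ Iᶜ) ↑)) v)
    × (((⟦ α ⟧ ᶜˡ) ∖ˢ ((⟦ α ⟧ ∖ˢ Iᶜ) ↑)) v → IsEquilibrium α v)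
theorem7 n α v =
  (λ (cv , mv , min) →
     (from (sound v) mv , cv) ,
     to (minimal⇔no-nonclassical-below cv) (λ u su → min u (to (sound u) su))) ,
  (λ ((sv , cv) , none) →
     cv , to (sound v) sv ,
     λ u mu → from (minimal⇔no-nonclassical-below cv) none u (from (sound u) mu))
  where
  sound : ∀ w → ⟦ α ⟧ w ⇔ IsModel α w
  sound = ⟦⟧⇔IsModel α
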